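{- The sequence $$0\longrightarrow 2\mathcal C(\mathbb Z)\longrightarrow \mathcal C(\mathbb Z)\xrightarrow{\ \alpha\ }\mathbb Q^\times/\mathbb Q^{\times2}$$ is exact; that is, the kernel of the homomorphism $\alpha$ restricted to $\mathcal C(\mathbb Z)$ equals $2\mathcal C(\mathbb Z)=\{P+P: P\in\mathcal C(\mathbb Z)\}$.
   Context: Let $d$ be a squarefree integer with $d\neq 1$, and put $\Delta=d$ if $d\equiv 1\pmod 4$ and $\Delta=4d$ if $d\equiv 2,3\pmod 4$. Let $\mathcal C(\mathbb Z)=\{(x,y)\in\mathbb Z^2: x^2-\Delta y^2=4\}$, an abelian group with neutral element $(2,0)$ and addition $(r,s)+(t,u)=\big(\frac{rt+\Delta su}{2},\frac{ru+st}{2}\big)$; in particular $2(r,s)=(r^2-2,rs)$. The map $\alpha:\mathcal C(\mathbb Z)\to\mathbb Q^\times/\mathbb Q^{\times2}$ is $\alpha(x,y)=(x+2)\mathbb Q^{\times2}$ if $x\neq -2$ and $\alpha(-2,0)=-\Delta\,\mathbb Q^{\times2}$; it is a group homomorphism. -}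

module Defs where

open import Data.Nat using (ℕ)
import Data.Nat as ℕ
open import Data.Integer using (ℤ; +_; -[1+_]; _+_; _*_; _-_; -_; ∣_∣)
open import Data.Integer.DivMod using (_/ℕ_; _%ℕ_)
open import Data.Rational using (ℚ) renaming (_*_ to _*ℚ_; _/_ to _/ℚ_)
open import Data.Product using (Σ; ∃; _×_; _,_; proj₁; proj₂)
open import Relation.Binary.PropositionalEquality using (_≡_)
open import Relation.Nullary using (¬_)
open import Data.Nat.Divisibility using () renaming (_∣_ to _∣ℕ_)

-- d is squarefree: the only natural number whose square divides d is 1
-- (in particular d ≠ 0).
SquareFree : ℤ → Set
SquareFree d = ∀ (n : ℕ) → (n ℕ.* n) ∣ℕ ∣ d ∣ → n ≡ 1

Disc : ℤ → ℤ
Disc d with d %ℕ 4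
... | 1 = d
... | _ = + 4 * d

OnCurve : ℤ → ℤ × ℤ → Set
OnCurve Δ (x , y) = x * x - Δ * (y * y) ≡ + 4

C : ℤ → Set
C Δ = Σ (ℤ × ℤ) (OnCurve Δ)

-- group law (r,s)+(t,u) = ((rt + Δsu)/2, (ru + st)/2); the divisions are exact on C(ℤ)
addPt : ℤ → ℤ × ℤ → ℤ × ℤ → ℤ × ℤ
addPt Δ (r , s) (t , u) = ((r * t + Δ * (s * u)) /ℕ 2) , ((r * u + s * t) /ℕ 2)

-- the map α : C(ℤ) → ℚ^×/ℚ^×2, given by an integer representative of the square class
α : ℤ → ℤ × ℤ → ℤ
α Δ (x , y) with x
... | -[1+ 1 ] = - Δ
... | x' = x' + + 2

-- a nonzero rational (given here by an integer) is trivial in ℚ^×/ℚ^×2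
-- iff it is the square of a rational number
IsRationalSquare : ℤ → Set
IsRationalSquare m = ∃ λ (q : ℚ) → q *ℚ q ≡ (m /ℚ 1)

{-# OPTIONS --safe #-}
-- Doubling gives 2(r, s) = (r² - 2, rs), so α(2Q) is the square r², or -Δ = (2/s)² when r = 0.
-- Conversely, if x + 2 = k² then Δy² = x² - 4 = k²(k² - 4); as d is squarefree (after a parity
-- argument when Δ = 4d) k divides y, and (k, y/k) is a point doubling to (x, y). At x = -2 we
-- have y = 0, and -Δ can only be a square for Δ ∈ {-1, -4}, halved by (0, 2) and (0, 1).
-- An integer that is a rational square is an integer square, since a reduced denominator is
-- coprime to the numerator.
module Submission where

open import Defs
open import Data.Empty using (⊥-elim)
open import Data.Integer as ℤ using (ℤ; +_; -[1+_]; -1ℤ; _+_; _*_; _-_; -_; ∣_∣; _/ℕ_)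
import Data.Integer.Properties as ℤ
open import Data.Integer.Divisibility.Signed using (_∣_; divides; ∣ᵤ⇒∣; ∣⇒∣ᵤ; ∣m+n∣n⇒∣m)
open import Data.Integer.Tactic.RingSolver using (solve)
open import Data.List using ([]; _∷_)
open import Data.Nat as ℕ using (suc)
import Data.Nat.Properties as ℕ
import Data.Nat.DivMod as ℕ
open import Data.Nat.Coprimality as Coprimality using (Coprime)
open import Data.Nat.Divisibility as ℕ using () renaming (_∣_ to _∣ℕ_)
open import Data.Nat.GCD using (gcd; gcd[m,n]∣m; gcd[m,n]∣n; gcd[m,n]≢0)
open import Data.Nat.Primality using (Prime; prime[2]; euclidsLemma)
open import Data.Nat.Tactic.RingSolver using () renaming (solve to solveℕ)
open import Data.Product using (∃; _×_; _,_)
open import Data.Rational as ℚ using (mkℚ; toℚᵘ; fromℚᵘ)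
import Data.Rational.Properties as ℚ
open import Data.Rational.Unnormalised as ℚᵘ using (mkℚᵘ; *≡*)
import Data.Rational.Unnormalised.Properties as ℚᵘ
open import Data.Sum as Sum using (_⊎_; inj₁; inj₂)
open import Function using (_∘_)
open import Function.Bundles using (_⇔_; mk⇔)
open import Relation.Binary.PropositionalEquality
  using (_≡_; _≢_; refl; sym; trans; cong; cong₂; subst; subst₂; module ≡-Reasoning)
open import Relation.Nullary using (¬_; yes; no)

isRationalSquare⇒square : ∀ m → IsRationalSquare m → ∃ λ k → m ≡ k * k
isRationalSquare⇒square m (q@(mkℚ n c-1 coprime) , q*q≡m)
  with ℚ./-injective-≃ (toℚᵘ q ℚᵘ.* toℚᵘ q) (mkℚᵘ m 0) q*q≡m
... | *≡* n*n≡m*c*c = n , square denominator≡1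
  where
  open ≡-Reasoning
  c = suc c-1
  c∣n*n : c ∣ℕ ∣ n ∣ ℕ.* ∣ n ∣
  c∣n*n = ℕ.divides (∣ m ∣ ℕ.* c) (begin
    ∣ n ∣ ℕ.* ∣ n ∣       ≡⟨ ℤ.abs-* n n ⟨
    ∣ n * n ∣             ≡⟨ cong ∣_∣ (ℤ.*-identityʳ (n * n)) ⟨
    ∣ n * n * + 1 ∣       ≡⟨ cong ∣_∣ n*n≡m*c*c ⟩
    ∣ m * + (c ℕ.* c) ∣   ≡⟨ ℤ.abs-* m (+ (c ℕ.* c)) ⟩
    ∣ m ∣ ℕ.* (c ℕ.* c)   ≡⟨ ℕ.*-assoc ∣ m ∣ c c ⟨
    ∣ m ∣ ℕ.* c ℕ.* c     ∎)
  c⊥n : Coprime c ∣ n ∣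
  c⊥n = Coprimality.sym (Coprimality.recompute coprime)
  denominator≡1 : c ≡ 1
  denominator≡1 = c⊥n (ℕ.∣-refl , Coprimality.coprime-divisor c⊥n c∣n*n)
  square : c ≡ 1 → m ≡ n * n
  square refl = trans (sym (ℤ.*-identityʳ m)) (trans (sym n*n≡m*c*c) (ℤ.*-identityʳ (n * n)))

square-denominator⇒isRationalSquare : ∀ m t n →
  m * + (suc n ℕ.* suc n) ≡ t * t → IsRationalSquare m
square-denominator⇒isRationalSquare m t n eq = q , ℚ.toℚᵘ-injective (begin
    toℚᵘ (q ℚ.* q)       ≈⟨ ℚ.toℚᵘ-homo-* q q ⟩
    toℚᵘ q ℚᵘ.* toℚᵘ q   ≈⟨ ℚᵘ.*-cong (ℚ.toℚᵘ-fromℚᵘ u) (ℚ.toℚᵘ-fromℚᵘ u) ⟩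
    u ℚᵘ.* u             ≈⟨ *≡* (trans (ℤ.*-identityʳ (t * t)) (sym eq)) ⟩
    mkℚᵘ m 0             ≈⟨ ℚ.toℚᵘ-fromℚᵘ (mkℚᵘ m 0) ⟨
    toℚᵘ (m ℚ./ 1)       ∎)
  where
  open ℚᵘ.≃-Reasoning
  u = mkℚᵘ t n
  q = fromℚᵘ u

ratio-square⇒isRationalSquare : ∀ {m s t} → s ≢ + 0 → m * (s * s) ≡ t * t → IsRationalSquare m
ratio-square⇒isRationalSquare {s = + 0} s≢0 _ = ⊥-elim (s≢0 refl)
ratio-square⇒isRationalSquare {m} {ℤ.+[1+ n ]} {t} _ eq = square-denominator⇒isRationalSquare m t n eq
ratio-square⇒isRationalSquare {m} { -[1+ n ]} {t} _ eq = square-denominator⇒isRationalSquare m t n eq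

square⇒isRationalSquare : ∀ {m k} → m ≡ k * k → IsRationalSquare m
square⇒isRationalSquare {m} {k} m≡k*k =
  ratio-square⇒isRationalSquare {m} {+ 1} {k} (λ ()) (trans (ℤ.*-identityʳ m) m≡k*k)

coprime-square : ∀ {m n} → Coprime m n → Coprime (m ℕ.* m) n
coprime-square {m} {n} m⊥n {i} (i∣m*m , i∣n) = m⊥n (Coprimality.coprime-divisor i⊥m i∣m*m , i∣n)
  where
  i⊥m : Coprime i m
  i⊥m (j∣i , j∣m) = m⊥n (j∣m , ℕ.∣-trans j∣i i∣n)

squarefree-coprime-square∣⇒≡1 : ∀ {D K Y} → (∀ n → n ℕ.* n ∣ℕ D → n ≡ 1) →
  Coprime K Y → K ℕ.* K ∣ℕ D ℕ.* (Y ℕ.* Y) → K ≡ 1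
squarefree-coprime-square∣⇒≡1 {D} {K} {Y} squarefree K⊥Y K²∣DY² =
  squarefree K (Coprimality.coprime-divisor K²⊥Y (Coprimality.coprime-divisor K²⊥Y K²∣YYD))
  where
  K²⊥Y : Coprime (K ℕ.* K) Y
  K²⊥Y = coprime-square K⊥Y
  K²∣YYD : K ℕ.* K ∣ℕ Y ℕ.* (Y ℕ.* D)
  K²∣YYD = subst (K ℕ.* K ∣ℕ_) (trans (ℕ.*-comm D (Y ℕ.* Y)) (ℕ.*-assoc Y Y D)) K²∣DY²

square∣*square-cancel : ∀ a b c g .{{_ : ℕ.NonZero g}} →
  (a ℕ.* g) ℕ.* (a ℕ.* g) ∣ℕ c ℕ.* ((b ℕ.* g) ℕ.* (b ℕ.* g)) → a ℕ.* a ∣ℕ c ℕ.* (b ℕ.* b)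
square∣*square-cancel a b c g h = ℕ.*-cancelˡ-∣ (g ℕ.* g) {{ℕ.m*n≢0 g g}} (begin
  (g ℕ.* g) ℕ.* (a ℕ.* a)            ≡⟨ solveℕ (a ∷ g ∷ []) ⟩
  (a ℕ.* g) ℕ.* (a ℕ.* g)            ∣⟨ h ⟩
  c ℕ.* ((b ℕ.* g) ℕ.* (b ℕ.* g))    ≡⟨ solveℕ (b ∷ c ∷ g ∷ []) ⟩
  (g ℕ.* g) ℕ.* (c ℕ.* (b ℕ.* b))    ∎)
  where open ℕ.∣-Reasoning

square∣squarefree*square⇒∣ : ∀ {D K Y} → (∀ n → n ℕ.* n ∣ℕ D → n ≡ 1) →
  K ≢ 0 → K ℕ.* K ∣ℕ D ℕ.* (Y ℕ.* Y) → K ∣ℕ Y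
square∣squarefree*square⇒∣ {D} {K} {Y} squarefree K≢0 K²∣DY² = subst (_∣ℕ Y) g≡K (gcd[m,n]∣n K Y)
  where
  g = gcd K Y
  instance
    g≢0 : ℕ.NonZero g
    g≢0 = ℕ.≢-nonZero (gcd[m,n]≢0 K Y (inj₁ K≢0))
  K′ = K ℕ./ g
  Y′ = Y ℕ./ g
  K≡K′g : K ≡ K′ ℕ.* g
  K≡K′g = sym (ℕ.m/n*n≡m (gcd[m,n]∣m K Y))
  Y≡Y′g : Y ≡ Y′ ℕ.* g
  Y≡Y′g = sym (ℕ.m/n*n≡m (gcd[m,n]∣n K Y))
  K′≡1 : K′ ≡ 1
  K′≡1 = squarefree-coprime-square∣⇒≡1 squarefree (Coprimality.coprime-/gcd K Y)
    (square∣*square-cancel K′ Y′ D g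
      (subst₂ (λ k y → k ℕ.* k ∣ℕ D ℕ.* (y ℕ.* y)) K≡K′g Y≡Y′g K²∣DY²))
  g≡K : g ≡ K
  g≡K = sym (trans K≡K′g (trans (cong (ℕ._* g) K′≡1) (ℕ.*-identityˡ g)))

squareFree⇒≢0 : ∀ {d} → SquareFree d → d ≢ + 0
squareFree⇒≢0 {d} squarefree refl with squarefree 2 (ℕ.divides 0 refl)
... | ()

squareFree-square∣⇒∣ : ∀ {d k y} → SquareFree d → k ≢ + 0 → k * k ∣ d * (y * y) → k ∣ y
squareFree-square∣⇒∣ {d} {k} {y} squarefree k≢0 k²∣dy² =
  ∣ᵤ⇒∣ (square∣squarefree*square⇒∣ squarefree (k≢0 ∘ ℤ.∣i∣≡0⇒i≡0) ∣k∣²∣∣d∣∣y∣²)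
  where
  ∣k∣²∣∣d∣∣y∣² : ∣ k ∣ ℕ.* ∣ k ∣ ∣ℕ ∣ d ∣ ℕ.* (∣ y ∣ ℕ.* ∣ y ∣)
  ∣k∣²∣∣d∣∣y∣² = subst₂ _∣ℕ_ (ℤ.abs-* k k)
    (trans (ℤ.abs-* d (y * y)) (cong (∣ d ∣ ℕ.*_) (ℤ.abs-* y y))) (∣⇒∣ᵤ k²∣dy²)

∣i∣≡1⇒i*i≡1 : ∀ {i} → ∣ i ∣ ≡ 1 → i * i ≡ + 1
∣i∣≡1⇒i*i≡1 {ℤ.+[1+ 0 ]} _ = refl
∣i∣≡1⇒i*i≡1 { -[1+ 0 ]} _ = refl
∣i∣≡1⇒i*i≡1 {+ 0} ()
∣i∣≡1⇒i*i≡1 {ℤ.+[1+ suc _ ]} ()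
∣i∣≡1⇒i*i≡1 { -[1+ suc _ ]} ()

squareFree-neg-square⇒≡-1 : ∀ {d k} → SquareFree d → - d ≡ k * k → d ≡ -1ℤ
squareFree-neg-square⇒≡-1 {d} {k} squarefree -d≡k² = begin
  d          ≡⟨ ℤ.neg-involutive d ⟨
  - - d      ≡⟨ cong -_ -d≡k² ⟩
  - (k * k)  ≡⟨ cong -_ (∣i∣≡1⇒i*i≡1 {k} (squarefree ∣ k ∣ (ℕ.divides 1 ∣d∣≡1*∣k∣²))) ⟩
  -1ℤ        ∎
  where
  open ≡-Reasoning
  ∣d∣≡1*∣k∣² : ∣ d ∣ ≡ 1 ℕ.* (∣ k ∣ ℕ.* ∣ k ∣)
  ∣d∣≡1*∣k∣² = trans (sym (ℤ.∣-i∣≡∣i∣ d))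
    (trans (cong ∣_∣ -d≡k²) (trans (ℤ.abs-* k k) (sym (ℕ.*-identityˡ _))))

p∣i*j⇒p∣i⊎p∣j : ∀ {p} i j → Prime p → + p ∣ i * j → (+ p ∣ i) ⊎ (+ p ∣ j)
p∣i*j⇒p∣i⊎p∣j i j p-prime p∣ij = Sum.map ∣ᵤ⇒∣ ∣ᵤ⇒∣
  (euclidsLemma ∣ i ∣ ∣ j ∣ p-prime (subst (_ ∣ℕ_) (ℤ.abs-* i j) (∣⇒∣ᵤ p∣ij)))

p∣i*i⇒p∣i : ∀ {p} i → Prime p → + p ∣ i * i → + p ∣ i
p∣i*i⇒p∣i i p-prime p∣ii = Sum.reduce (p∣i*j⇒p∣i⊎p∣j i i p-prime p∣ii)

2∣k²[k²-4]⇒2∣k : ∀ {k} → + 2 ∣ (k * k) * (k * k - + 4) → + 2 ∣ k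
2∣k²[k²-4]⇒2∣k {k} 2∣k²[k²-4] = p∣i*i⇒p∣i k prime[2]
  (Sum.fromInj₁ (λ 2∣k²-4 → ∣m+n∣n⇒∣m 2∣k²-4 (divides (- + 2) refl))
   (p∣i*j⇒p∣i⊎p∣j (k * k) (k * k - + 4) prime[2] 2∣k²[k²-4]))

i*i≡0⇒i≡0 : ∀ {i} → i * i ≡ + 0 → i ≡ + 0
i*i≡0⇒i≡0 {i} ii≡0 = Sum.reduce (ℤ.i*j≡0⇒i≡0∨j≡0 i ii≡0)

[i*n]/ℕn≡i : ∀ i n .{{_ : ℕ.NonZero n}} → (i * + n) /ℕ n ≡ i
[i*n]/ℕn≡i (+ m) n = trans (cong (_/ℕ n) (sym (ℤ.pos-* m n))) (cong +_ (ℕ.m*n/n≡m m n))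
[i*n]/ℕn≡i -[1+ m ] n@(suc _) with suc m ℕ.* n ℕ.% n | ℕ.m*n%n≡0 (suc m) n
... | .0 | refl = cong (λ k → - (+ k)) (ℕ.m*n/n≡m (suc m) n)

i≡j*n⇒i/ℕn≡j : ∀ {i j n} .{{_ : ℕ.NonZero n}} → i ≡ j * + n → i /ℕ n ≡ j
i≡j*n⇒i/ℕn≡j {j = j} {n} refl = [i*n]/ℕn≡i j n

i+j≡k⇒i≡k-j : ∀ {i j k} → i + j ≡ k → i ≡ k - j
i+j≡k⇒i≡k-j {i} {j} {k} i+j≡k = begin
  i            ≡⟨ solve (i ∷ j ∷ []) ⟩
  i + j - j    ≡⟨ cong (_- j) i+j≡k ⟩
  k - j        ∎
  where open ≡-Reasoning

module Curve (Δ : ℤ) where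

  onCurve⇒Δy²≡x²-4 : ∀ x y → OnCurve Δ (x , y) → Δ * (y * y) ≡ x * x - + 4
  onCurve⇒Δy²≡x²-4 x y on = begin
    Δ * (y * y)                      ≡⟨ solve (Δ ∷ x ∷ y ∷ []) ⟩
    x * x - (x * x - Δ * (y * y))    ≡⟨ cong (λ z → x * x - z) on ⟩
    x * x - + 4                      ∎
    where open ≡-Reasoning

  Δy²≡x²-4⇒onCurve : ∀ x y → Δ * (y * y) ≡ x * x - + 4 → OnCurve Δ (x , y)
  Δy²≡x²-4⇒onCurve x y eq = begin
    x * x - Δ * (y * y)        ≡⟨ cong (λ z → x * x - z) eq ⟩
    x * x - (x * x - + 4)      ≡⟨ solve (x ∷ []) ⟩
    + 4                        ∎
    where open ≡-Reasoning

  addPt-self : ∀ r s → OnCurve Δ (r , s) → addPt Δ (r , s) (r , s) ≡ (r * r - + 2 , r * s)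
  addPt-self r s on = cong₂ _,_ (i≡j*n⇒i/ℕn≡j abscissa) (i≡j*n⇒i/ℕn≡j ordinate)
    where
    abscissa : r * r + Δ * (s * s) ≡ (r * r - + 2) * + 2
    abscissa = begin
      r * r + Δ * (s * s)      ≡⟨ cong (λ z → r * r + z) (onCurve⇒Δy²≡x²-4 r s on) ⟩
      r * r + (r * r - + 4)    ≡⟨ solve (r ∷ []) ⟩
      (r * r - + 2) * + 2      ∎
      where open ≡-Reasoning
    ordinate : r * s + s * r ≡ (r * s) * + 2
    ordinate = solve (r ∷ s ∷ [])

  x≢-2⇒α≡x+2 : ∀ {x y} → x ≢ - + 2 → α Δ (x , y) ≡ x + + 2
  x≢-2⇒α≡x+2 {+ _} _ = refl
  x≢-2⇒α≡x+2 { -[1+ 0 ]} _ = refl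
  x≢-2⇒α≡x+2 { -[1+ 1 ]} x≢-2 = ⊥-elim (x≢-2 refl)
  x≢-2⇒α≡x+2 { -[1+ suc (suc _) ]} _ = refl

  double∈kerα : ∀ r s → OnCurve Δ (r , s) → IsRationalSquare (α Δ (r * r - + 2 , r * s))
  double∈kerα r s on with r ℤ.≟ + 0
  ... | yes refl = ratio-square⇒isRationalSquare { - Δ} {s} {+ 2} s≢0
    (trans (sym (ℤ.neg-distribˡ-* Δ (s * s))) (cong -_ (onCurve⇒Δy²≡x²-4 (+ 0) s on)))
    where
    s≢0 : s ≢ + 0
    s≢0 refl with trans (sym (ℤ.*-zeroʳ Δ)) (onCurve⇒Δy²≡x²-4 (+ 0) (+ 0) on)
    ... | ()
  ... | no r≢0 = subst IsRationalSquare (sym (x≢-2⇒α≡x+2 {y = r * s} r²-2≢-2))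
    (square⇒isRationalSquare {r * r - + 2 + + 2} {r} (solve (r ∷ [])))
    where
    r²-2≢-2 : r * r - + 2 ≢ - + 2
    r²-2≢-2 r²-2≡-2 = r≢0 (i*i≡0⇒i≡0 (begin
      r * r                  ≡⟨ solve (r ∷ []) ⟩
      (r * r - + 2) + + 2    ≡⟨ cong (_+ + 2) r²-2≡-2 ⟩
      + 0                    ∎))
      where open ≡-Reasoning

  onCurve[x≡-2]⇒y≡0 : ∀ {y} → Δ ≢ + 0 → OnCurve Δ (- + 2 , y) → y ≡ + 0
  onCurve[x≡-2]⇒y≡0 {y} Δ≢0 on =
    i*i≡0⇒i≡0 (Sum.fromInj₂ (⊥-elim ∘ Δ≢0) (ℤ.i*j≡0⇒i≡0∨j≡0 Δ (onCurve⇒Δy²≡x²-4 (- + 2) y on)))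

  onCurve[x≡k²-2]⇒Δy²≡k²[k²-4] : ∀ k y → OnCurve Δ (k * k - + 2 , y) →
    Δ * (y * y) ≡ (k * k) * (k * k - + 4)
  onCurve[x≡k²-2]⇒Δy²≡k²[k²-4] k y on = trans (onCurve⇒Δy²≡x²-4 (k * k - + 2) y on) (solve (k ∷ []))

  halve-onCurve : ∀ k s → k ≢ + 0 → OnCurve Δ (k * k - + 2 , s * k) → OnCurve Δ (k , s)
  halve-onCurve k s k≢0 on =
    Δy²≡x²-4⇒onCurve k s (ℤ.*-cancelˡ-≡ (k * k) (Δ * (s * s)) (k * k - + 4) {{k²≢0}} (begin
      k * k * (Δ * (s * s))      ≡⟨ solve (Δ ∷ k ∷ s ∷ []) ⟩
      Δ * ((s * k) * (s * k))    ≡⟨ onCurve[x≡k²-2]⇒Δy²≡k²[k²-4] k (s * k) on ⟩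
      k * k * (k * k - + 4)      ∎))
    where
    open ≡-Reasoning
    k²≢0 : ℤ.NonZero (k * k)
    k²≢0 = ℤ.≢-nonZero (k≢0 ∘ i*i≡0⇒i≡0)

  2C⊆kerα : ∀ {Q} → OnCurve Δ Q → IsRationalSquare (α Δ (addPt Δ Q Q))
  2C⊆kerα {r , s} on = subst (IsRationalSquare ∘ α Δ) (sym (addPt-self r s on)) (double∈kerα r s on)

-- The arithmetic of Δ used to halve points of ker α: (k² - 2, y) halves to (k, y/k), and
-- (-2, 0) halves to (0, s) with Δs² = -4.
record Admissible (Δ : ℤ) : Set where
  field
    Δ≢0        : Δ ≢ + 0
    k∣y        : ∀ {k y} → k ≢ + 0 → Δ * (y * y) ≡ (k * k) * (k * k - + 4) → k ∣ y
    neg-square : ∀ {k} → - Δ ≡ k * k → ∃ λ s → Δ * (s * s) ≡ - + 4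

module _ {Δ : ℤ} (admissible : Admissible Δ) where
  open Admissible admissible
  open Curve Δ

  halve[x≡-2] : ∀ {y} → OnCurve Δ (- + 2 , y) → IsRationalSquare (- Δ) →
    ∃ λ Q → OnCurve Δ Q × addPt Δ Q Q ≡ (- + 2 , y)
  halve[x≡-2] {y} on -Δ-square
    with onCurve[x≡-2]⇒y≡0 {y} Δ≢0 on | isRationalSquare⇒square (- Δ) -Δ-square
  ... | refl | k , -Δ≡k² with neg-square {k} -Δ≡k²
  ... | s , Δs²≡-4 = (+ 0 , s) , on½ , addPt-self (+ 0) s on½
    where
    on½ : OnCurve Δ (+ 0 , s)
    on½ = Δy²≡x²-4⇒onCurve (+ 0) s Δs²≡-4

  halve[x≡k²-2] : ∀ {k y} → k ≢ + 0 → OnCurve Δ (k * k - + 2 , y) →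
    ∃ λ Q → OnCurve Δ Q × addPt Δ Q Q ≡ (k * k - + 2 , y)
  halve[x≡k²-2] {k} {y} k≢0 on with k∣y {y = y} k≢0 (onCurve[x≡k²-2]⇒Δy²≡k²[k²-4] k y on)
  ... | divides s refl =
    (k , s) , on½ , trans (addPt-self k s on½) (cong (k * k - + 2 ,_) (ℤ.*-comm k s))
    where
    on½ : OnCurve Δ (k , s)
    on½ = halve-onCurve k s k≢0 on

  kerα⊆2C : ∀ {P} → OnCurve Δ P → IsRationalSquare (α Δ P) → ∃ λ Q → OnCurve Δ Q × addPt Δ Q Q ≡ P
  kerα⊆2C {x , y} on α-square with x ℤ.≟ - + 2
  ... | yes refl = halve[x≡-2] on α-square
  ... | no x≢-2
    with isRationalSquare⇒square (x + + 2) (subst IsRationalSquare (x≢-2⇒α≡x+2 {y = y} x≢-2) α-square)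
  ... | k , x+2≡k² with i+j≡k⇒i≡k-j {x} {+ 2} {k * k} x+2≡k²
  ... | refl = halve[x≡k²-2] k≢0 on
    where
    k≢0 : k ≢ + 0
    k≢0 refl = x≢-2 refl

open Admissible

squareFree⇒admissible : ∀ {d} → SquareFree d → Admissible d
squareFree⇒admissible {d} squarefree .Δ≢0 = squareFree⇒≢0 {d} squarefree
squareFree⇒admissible {d} squarefree .k∣y {k} {y} k≢0 dy²≡k²[k²-4] =
  squareFree-square∣⇒∣ {d} {k} {y} squarefree k≢0
    (divides (k * k - + 4) (trans dy²≡k²[k²-4] (ℤ.*-comm (k * k) (k * k - + 4))))
squareFree⇒admissible {d} squarefree .neg-square {k} -d≡k² =
  + 2 , cong (_* (+ 2 * + 2)) (squareFree-neg-square⇒≡-1 {d} {k} squarefree -d≡k²)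

squareFree⇒admissible[4d] : ∀ {d} → SquareFree d → Admissible (+ 4 * d)
squareFree⇒admissible[4d] {d} squarefree .Δ≢0 4d≡0 with ℤ.i*j≡0⇒i≡0∨j≡0 (+ 4) 4d≡0
... | inj₂ d≡0 = squareFree⇒≢0 {d} squarefree d≡0
squareFree⇒admissible[4d] {d} squarefree .k∣y {k} {y} k≢0 eq
  with 2∣k²[k²-4]⇒2∣k {k} (divides (+ 2 * d * (y * y)) (begin
    (k * k) * (k * k - + 4)   ≡⟨ eq ⟨
    + 4 * d * (y * y)         ≡⟨ solve (d ∷ y ∷ []) ⟩
    + 2 * d * (y * y) * + 2   ∎))
  where open ≡-Reasoning
... | divides j refl = squareFree-square∣⇒∣ {d} {j * + 2} {y} squarefree k≢0
  (divides (j * j - + 1) (ℤ.*-cancelˡ-≡ (+ 4) (d * (y * y)) ((j * j - + 1) * ((j * + 2) * (j * + 2)))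
   (begin
    + 4 * (d * (y * y))                                      ≡⟨ solve (d ∷ y ∷ []) ⟩
    + 4 * d * (y * y)                                        ≡⟨ eq ⟩
    (j * + 2) * (j * + 2) * ((j * + 2) * (j * + 2) - + 4)    ≡⟨ solve (j ∷ []) ⟩
    + 4 * ((j * j - + 1) * ((j * + 2) * (j * + 2)))          ∎)))
  where open ≡-Reasoning
squareFree⇒admissible[4d] {d} squarefree .neg-square {k} eq
  with p∣i*i⇒p∣i k prime[2] (divides (- (+ 2 * d)) (begin
    k * k               ≡⟨ eq ⟨
    - (+ 4 * d)         ≡⟨ solve (d ∷ []) ⟩
    - (+ 2 * d) * + 2   ∎))
  where open ≡-Reasoning
... | divides j refl =
  + 1 , cong (λ d → + 4 * d * (+ 1 * + 1)) (squareFree-neg-square⇒≡-1 {d} {j} squarefree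
  (ℤ.*-cancelˡ-≡ (+ 4) (- d) (j * j) (begin
    + 4 * - d                ≡⟨ solve (d ∷ []) ⟩
    - (+ 4 * d)              ≡⟨ eq ⟩
    (j * + 2) * (j * + 2)    ≡⟨ solve (j ∷ []) ⟩
    + 4 * (j * j)            ∎)))
  where open ≡-Reasoning

disc≡d⊎4d : ∀ d → Disc d ≡ d ⊎ Disc d ≡ + 4 * d
disc≡d⊎4d d with d ℤ.%ℕ 4
... | 1 = inj₁ refl
... | 0 = inj₂ refl
... | suc (suc _) = inj₂ refl

squareFree⇒disc-admissible : ∀ {d} → SquareFree d → Admissible (Disc d)
squareFree⇒disc-admissible {d} squarefree with disc≡d⊎4d d
... | inj₁ Δ≡d  = subst Admissible (sym Δ≡d) (squareFree⇒admissible {d} squarefree)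
... | inj₂ Δ≡4d = subst Admissible (sym Δ≡4d) (squareFree⇒admissible[4d] {d} squarefree)

theorem3p7 : (d : ℤ) → SquareFree d → ¬ (d ≡ + 1) →
    (P : ℤ × ℤ) → OnCurve (Disc d) P →
    (IsRationalSquare (α (Disc d) P)
      ⇔ (∃ λ (Q : ℤ × ℤ) → OnCurve (Disc d) Q × (addPt (Disc d) Q Q ≡ P)))
theorem3p7 d squarefree _ P on = mk⇔
  (kerα⊆2C (squareFree⇒disc-admissible {d} squarefree) {P} on)
  (λ (Q , onQ , 2Q≡P) → subst (IsRationalSquare ∘ α (Disc d)) 2Q≡P (Curve.2C⊆kerα (Disc d) {Q} onQ))
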